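{- For $n\ge 1$ and $k\in\{1,\dots,2^{n-1}\}$, let $\mathbf{x}^{(n,k)}=\mathrm{decode}_n(2^{n-1}+k-1)\in\{0,1\}^n$ and define \[ v^n(k):=\operatorname{code}\big(\lambda(\mathbf{x}^{(n,k)})\big). \] Then: (i) $v^1(1)=0$; (ii) $v^2(1)=0$ and $v^2(2)=1$; (iii) for every $n\ge 3$ and every $k\in\{1,\dots,2^{n-1}\}$, \[ v^n(k)=2^{\binom{n-1}{2}}(k-1)+\sum_{j=1}^{n-2}2^{\binom{j}{2}}\big(S^{2^j}(k)-1\big), \] with the convention $\binom{1}{2}=0$.
   Context: For $\mathbf{x}=(x_1,\dots,x_n)\in\{0,1\}^n$, let $\lambda(\mathbf{x})\in\{0,1\}^{\binom n2}$ be the vector with coordinates $\lambda(\mathbf{x})_{ij}=\mathbf{1}(x_i=x_j)$ for $1\le i<j\le n$. The coordinates are listed in lexicographic order of the pairs: $(1,2),(1,3),\dots,(1,n),(2,3),\dots,(n-1,n)$. For $n=1$, $\lambda(\mathbf{x})$ is the empty vector. For a binary vector $\mathbf{y}=(y_1,\dots,y_m)$, define $\operatorname{code}(\mathbf{y})=\sum_{j=1}^m y_j2^{m-j}$, with the code of the empty vector equal to $0$. For $0\le a<2^n$, $\mathrm{decode}_n(a)$ is the unique $\mathbf{x}\in\{0,1\}^n$ with $\operatorname{code}(\mathbf{x})=a$; this is the $n$-bit binary representation of $a$, padded with leading zeros. Thus $\mathbf{x}^{(n,k)}$ ranges over the binary vectors of length $n$ with first coordinate $1$, in increasing numerical order.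 Alternating cycle function: for an integer $N\ge 2$ and a positive integer $k$, let $q=\lfloor (k-1)/N\rfloor$ and $r=k-qN\in\{1,\dots,N\}$. Set $S^N(k)=N+1-r$ if $q$ is even, and $S^N(k)=r$ if $q$ is odd. Background (known result, not part of the claim): the vectors $\lambda(\mathbf{x}^{(n,k)})$, $k=1,\dots,2^{n-1}$, are exactly the $2^{n-1}$ vertices of the polytope $\mathbf{1}-\operatorname{CUT}(n)=\{\mathbf{1}-\mathbf{z}:\mathbf{z}\in\operatorname{CUT}(n)\}$. Here $\operatorname{CUT}(n)$ is the convex hull of the cut vectors of the complete graph $K_n$. -}

module Defs where

open import Data.Nat using (ℕ; zero; suc; _+_; _*_; _∸_; _^_; NonZero)
open import Data.Nat.Properties using (m^n≢0; _≟_)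
open import Data.Nat.DivMod using (_/_; _%_)
open import Data.Bool using (Bool; true; false; if_then_else_)
open import Data.List using (List; []; _∷_; _++_; map; length)
open import Data.Vec using (Vec; []; _∷_; toList)
open import Relation.Nullary using (yes; no)

code : List Bool → ℕ
code = go 0
  where
  go : ℕ → List Bool → ℕ
  go acc []       = acc
  go acc (b ∷ bs) = go (2 * acc + (if b then 1 else 0)) bs

-- decode n a : the n-bit binary representation of a (leading zeros),
-- i.e. the digits of a mod 2^n, most significant first
bit : ℕ → Bool
bit zero    = false
bit (suc _) = true

decode : (n : ℕ) → ℕ → Vec Bool n
decode zero    a = []
decode (suc n) a = bit (((a / (2 ^ n)) {{m^n≢0 2 n}}) % 2) ∷ decode n a

eqb : Bool → Bool → Bool
eqb true  true  = true
eqb false false = true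
eqb _     _     = false

-- λ(x) : coordinates 1(x_i = x_j), i < j, in lexicographic order of pairs
lam : List Bool → List Bool
lam []       = []
lam (x ∷ xs) = map (eqb x) xs ++ lam xs

choose2 : ℕ → ℕ
choose2 zero    = 0
choose2 (suc m) = m + choose2 m

xvec : (n k : ℕ) → Vec Bool n
xvec n k = decode n (2 ^ (n ∸ 1) + k ∸ 1)

v : ℕ → ℕ → ℕ
v n k = code (lam (toList (xvec n k)))

-- alternating cycle function S^N(k), for N ≥ 2 (NonZero needed for division),
-- q = ⌊(k-1)/N⌋, r = k - qN; S = N+1-r if q even, r if q odd
S : (N : ℕ) → .{{NonZero N}} → ℕ → ℕ
S N k with (k ∸ 1) / N
... | q with q % 2 ≟ 0
...   | yes _ = N + 1 ∸ (k ∸ q * N)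
...   | no  _ = k ∸ q * N

sumFrom1 : ℕ → (ℕ → ℕ) → ℕ
sumFrom1 zero    f = 0
sumFrom1 (suc m) f = sumFrom1 m f + f (suc m)

{-# OPTIONS --safe #-}
module Submission where

-- Put a = k − 1 and x = x^(n,k). The leading bit of x is 1 and its remaining n − 1 bits are the
-- binary digits of a, so the first row (1(x_1 = x_l))_{l>1} of λ(x) is the expansion of a and
-- contributes 2^C(n−1,2)·a. A later row (1(x_i = x_l))_{l>i}, with j = n − i entries, is the last
-- j bits of x, i.e. the digits of a mod 2^j, copied if x_i = 1 (⌊a/2^j⌋ odd) and complemented if
-- x_i = 0 (⌊a/2^j⌋ even). Its code is thus a mod 2^j or 2^j − 1 − (a mod 2^j), which is
-- S^(2^j)(k) − 1 in either case.

open import Defs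
open import Data.Bool using (Bool; true; false; not; if_then_else_)
open import Data.List using (List; []; _∷_; _++_; map; length)
open import Data.List.Properties using (map-cong; map-id; length-map; length-++)
open import Data.Nat using (ℕ; zero; suc; _+_; _*_; _∸_; _^_; _≤_; _≥_; _<_; s≤s; NonZero)
open import Data.Nat.DivMod
  using (_/_; _%_; m≡m%n+[m/n]*n; m%n≡m∸m/n*n; m/n*n≤m; m%n<n; n%1≡0; m%n%n≡m%n; m<n⇒m%n≡m; m<n⇒m/n≡0; n/n≡1;
         %-remove-+ˡ; +-distrib-/-∣ˡ; m∣n⇒o%n%m≡o%m; m%[n*o]/o≡m/o%n)
open import Data.Nat.Divisibility using (n∣m*n; ∣-refl)
open import Data.Nat.Properties
  using (_≟_; +-comm; *-comm; +-identityʳ; *-identityʳ; +-suc; m+n∸n≡m; ∸-+-assoc; +-∸-assoc; m^n≢0)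
open import Data.Nat.Tactic.RingSolver using (solve-∀)
open import Data.Product using (_×_; _,_)
open import Data.Sum using (_⊎_; inj₁; inj₂)
open import Data.Vec using (_∷_; toList)
open import Data.Vec.Properties using (length-toList)
open import Relation.Nullary using (yes; no; contradiction)
open import Relation.Binary.PropositionalEquality using (_≡_; refl; sym; trans; cong; cong₂; module ≡-Reasoning)

open ≡-Reasoning

bitValue : Bool → ℕ
bitValue b = if b then 1 else 0

-- `code` runs an accumulator loop that is local to its definition; `codeFrom` is that loop,
-- recovered by unification from the unfolding of `code (b ∷ bs)`.
mutual
  codeFrom : ℕ → List Bool → ℕ
  codeFrom = _

  code-∷≡codeFrom : ∀ b bs → code (b ∷ bs) ≡ codeFrom (bitValue b) bs
  code-∷≡codeFrom b bs with bitValue b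
  ... | d = refl

codeFrom-acc : ∀ a bs → codeFrom a bs ≡ a * 2 ^ length bs + code bs
codeFrom-acc a []       = sym (trans (+-identityʳ _) (*-identityʳ a))
codeFrom-acc a (c ∷ bs) = begin
  codeFrom (2 * a + bitValue c) bs                       ≡⟨ codeFrom-acc (2 * a + bitValue c) bs ⟩
  (2 * a + bitValue c) * 2 ^ length bs + code bs         ≡⟨ shift a (bitValue c) (2 ^ length bs) (code bs) ⟩
  a * 2 ^ suc (length bs) + (bitValue c * 2 ^ length bs + code bs)
    ≡⟨ cong (a * 2 ^ suc (length bs) +_) (sym (codeFrom-acc (bitValue c) bs)) ⟩
  a * 2 ^ suc (length bs) + codeFrom (bitValue c) bs     ≡⟨ cong (a * 2 ^ suc (length bs) +_) (sym (code-∷≡codeFrom c bs)) ⟩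
  a * 2 ^ length (c ∷ bs) + code (c ∷ bs)                ∎
  where
  shift : ∀ a d N C → (2 * a + d) * N + C ≡ a * (2 * N) + (d * N + C)
  shift = solve-∀

code-∷ : ∀ b bs → code (b ∷ bs) ≡ bitValue b * 2 ^ length bs + code bs
code-∷ b bs = trans (code-∷≡codeFrom b bs) (codeFrom-acc (bitValue b) bs)

codeFrom-++ : ∀ a xs ys → codeFrom a (xs ++ ys) ≡ codeFrom (codeFrom a xs) ys
codeFrom-++ a []       ys = refl
codeFrom-++ a (x ∷ xs) ys = codeFrom-++ (2 * a + bitValue x) xs ys

code-++ : ∀ xs ys → code (xs ++ ys) ≡ code xs * 2 ^ length ys + code ys
code-++ xs ys = trans (codeFrom-++ 0 xs ys) (codeFrom-acc (code xs) ys)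

code-map-not+code : ∀ bs → code (map not bs) + (code bs + 1) ≡ 2 ^ length bs
code-map-not+code []           = refl
code-map-not+code (true ∷ bs)  = begin
  code (map not bs) + (code (true ∷ bs) + 1)          ≡⟨ cong (λ c → code (map not bs) + (c + 1)) (code-∷ true bs) ⟩
  code (map not bs) + ((1 * 2 ^ length bs + code bs) + 1)
    ≡⟨ shuffle (code (map not bs)) (2 ^ length bs) (code bs) ⟩
  2 ^ length bs + (code (map not bs) + (code bs + 1))  ≡⟨ cong (2 ^ length bs +_) (code-map-not+code bs) ⟩
  2 ^ length bs + 2 ^ length bs                       ≡⟨ double (2 ^ length bs) ⟩
  2 ^ length (true ∷ bs)                              ∎
  where
  shuffle : ∀ X N C → X + ((1 * N + C) + 1) ≡ N + (X + (C + 1))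
  shuffle = solve-∀
  double : ∀ N → N + N ≡ 2 * N
  double = solve-∀
code-map-not+code (false ∷ bs) = begin
  code (true ∷ map not bs) + (code bs + 1)
    ≡⟨ cong (_+ (code bs + 1)) (code-∷ true (map not bs)) ⟩
  (1 * 2 ^ length (map not bs) + code (map not bs)) + (code bs + 1)
    ≡⟨ cong (λ l → (1 * 2 ^ l + code (map not bs)) + (code bs + 1)) (length-map not bs) ⟩
  (1 * 2 ^ length bs + code (map not bs)) + (code bs + 1)
    ≡⟨ shuffle (code (map not bs)) (2 ^ length bs) (code bs) ⟩
  2 ^ length bs + (code (map not bs) + (code bs + 1))  ≡⟨ cong (2 ^ length bs +_) (code-map-not+code bs) ⟩
  2 ^ length bs + 2 ^ length bs                       ≡⟨ double (2 ^ length bs) ⟩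
  2 ^ length (false ∷ bs)                             ∎
  where
  shuffle : ∀ X N C → (1 * N + X) + (C + 1) ≡ N + (X + (C + 1))
  shuffle = solve-∀
  double : ∀ N → N + N ≡ 2 * N
  double = solve-∀

code-map-not : ∀ bs → code (map not bs) ≡ 2 ^ length bs ∸ code bs ∸ 1
code-map-not bs = begin
  code (map not bs)                                   ≡⟨ m+n∸n≡m (code (map not bs)) (code bs + 1) ⟨
  code (map not bs) + (code bs + 1) ∸ (code bs + 1)   ≡⟨ cong (_∸ (code bs + 1)) (code-map-not+code bs) ⟩
  2 ^ length bs ∸ (code bs + 1)                       ≡⟨ ∸-+-assoc (2 ^ length bs) (code bs) 1 ⟨
  2 ^ length bs ∸ code bs ∸ 1                         ∎

eqb-true : ∀ b → eqb true b ≡ b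
eqb-true true  = refl
eqb-true false = refl

map-eqb-true : ∀ bs → map (eqb true) bs ≡ bs
map-eqb-true bs = trans (map-cong eqb-true bs) (map-id bs)

eqb-false : ∀ b → eqb false b ≡ not b
eqb-false true  = refl
eqb-false false = refl

length-lam : ∀ bs → length (lam bs) ≡ choose2 (length bs)
length-lam []       = refl
length-lam (b ∷ bs) = trans (length-++ (map (eqb b) bs)) (cong₂ _+_ (length-map (eqb b) bs) (length-lam bs))

code-lam-∷ : ∀ b bs → code (lam (b ∷ bs)) ≡ code (map (eqb b) bs) * 2 ^ choose2 (length bs) + code (lam bs)
code-lam-∷ b bs = trans (code-++ (map (eqb b) bs) (lam bs))
  (cong (λ l → code (map (eqb b) bs) * 2 ^ l + code (lam bs)) (length-lam bs))

n%2≡0⊎n%2≡1 : ∀ n → n % 2 ≡ 0 ⊎ n % 2 ≡ 1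
n%2≡0⊎n%2≡1 n with n % 2 | m%n<n n 2
... | 0           | _               = inj₁ refl
... | 1           | _               = inj₂ refl
... | suc (suc _) | s≤s (s≤s ())

bitValue-bit-%2 : ∀ n → bitValue (bit (n % 2)) ≡ n % 2
bitValue-bit-%2 n with n%2≡0⊎n%2≡1 n
... | inj₁ even rewrite even = refl
... | inj₂ odd  rewrite odd  = refl

m%[n*o]≡m%o+m/o%n*o : ∀ m n o .{{_ : NonZero n}} .{{_ : NonZero o}} {{_ : NonZero (n * o)}} →
                      m % (n * o) ≡ m % o + m / o % n * o
m%[n*o]≡m%o+m/o%n*o m n o = begin
  r                   ≡⟨ m≡m%n+[m/n]*n r o ⟩
  r % o + r / o * o   ≡⟨ cong₂ (λ x y → x + y * o) (m∣n⇒o%n%m≡o%m o (n * o) m (n∣m*n n)) (m%[n*o]/o≡m/o%n m n o) ⟩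
  m % o + m / o % n * o ∎
  where
  r = m % (n * o)

code-decode : ∀ p a → code (toList (decode p a)) ≡ (a % 2 ^ p) {{m^n≢0 2 p}}
code-decode zero    a = sym (n%1≡0 a)
code-decode (suc p) a = begin
  code (bit (a / 2 ^ p % 2) ∷ toList (decode p a))
    ≡⟨ code-∷ (bit (a / 2 ^ p % 2)) (toList (decode p a)) ⟩
  bitValue (bit (a / 2 ^ p % 2)) * 2 ^ length (toList (decode p a)) + code (toList (decode p a))
    ≡⟨ cong₂ (λ b l → b * 2 ^ l + code (toList (decode p a))) (bitValue-bit-%2 (a / 2 ^ p)) (length-toList (decode p a)) ⟩
  a / 2 ^ p % 2 * 2 ^ p + code (toList (decode p a))
    ≡⟨ cong (a / 2 ^ p % 2 * 2 ^ p +_) (code-decode p a) ⟩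
  a / 2 ^ p % 2 * 2 ^ p + a % 2 ^ p
    ≡⟨ +-comm (a / 2 ^ p % 2 * 2 ^ p) (a % 2 ^ p) ⟩
  a % 2 ^ p + a / 2 ^ p % 2 * 2 ^ p
    ≡⟨ m%[n*o]≡m%o+m/o%n*o a 2 (2 ^ p) ⟨
  a % 2 ^ suc p ∎
  where
  instance
    _ = m^n≢0 2 p
    _ = m^n≢0 2 (suc p)

decode-% : ∀ p a → decode p ((a % 2 ^ p) {{m^n≢0 2 p}}) ≡ decode p a
decode-% zero    a = refl
decode-% (suc p) a = cong₂ _∷_ (cong bit leadingDigit) (begin
  decode p (a % 2 ^ suc p)         ≡⟨ decode-% p (a % 2 ^ suc p) ⟨
  decode p (a % 2 ^ suc p % 2 ^ p) ≡⟨ cong (decode p) (m∣n⇒o%n%m≡o%m (2 ^ p) (2 ^ suc p) a (n∣m*n 2)) ⟩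
  decode p (a % 2 ^ p)             ≡⟨ decode-% p a ⟩
  decode p a                       ∎)
  where
  instance
    _ = m^n≢0 2 p
    _ = m^n≢0 2 (suc p)
  leadingDigit : a % 2 ^ suc p / 2 ^ p % 2 ≡ a / 2 ^ p % 2
  leadingDigit = trans (cong (_% 2) (m%[n*o]/o≡m/o%n a 2 (2 ^ p))) (m%n%n≡m%n (a / 2 ^ p) 2)

decode-suc-2^+ : ∀ p {m} → m < 2 ^ p → decode (suc p) (2 ^ p + m) ≡ true ∷ decode p m
decode-suc-2^+ p {m} m<2^p = cong₂ _∷_ (cong (λ q → bit (q % 2)) leadingDigit) (begin
  decode p (2 ^ p + m)           ≡⟨ decode-% p (2 ^ p + m) ⟨
  decode p ((2 ^ p + m) % 2 ^ p) ≡⟨ cong (decode p) (%-remove-+ˡ m ∣-refl) ⟩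
  decode p (m % 2 ^ p)           ≡⟨ decode-% p m ⟩
  decode p m                     ∎)
  where
  instance _ = m^n≢0 2 p
  leadingDigit : (2 ^ p + m) / 2 ^ p ≡ 1
  leadingDigit = trans (+-distrib-/-∣ˡ m ∣-refl) (cong₂ _+_ (n/n≡1 (2 ^ p)) (m<n⇒m/n≡0 m<2^p))

suc∸m/n*n≡suc[m%n] : ∀ m n .{{_ : NonZero n}} → suc m ∸ m / n * n ≡ suc (m % n)
suc∸m/n*n≡suc[m%n] m n = trans (+-∸-assoc 1 (m/n*n≤m m n)) (cong suc (sym (m%n≡m∸m/n*n m n)))

S-suc-even : ∀ N .{{_ : NonZero N}} m → m / N % 2 ≡ 0 → S N (suc m) ≡ N ∸ m % N
S-suc-even N m even with m / N % 2 ≟ 0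
... | yes _   = trans (cong (N + 1 ∸_) (suc∸m/n*n≡suc[m%n] m N)) (cong (_∸ suc (m % N)) (+-comm N 1))
... | no odd  = contradiction even odd

S-suc-odd : ∀ N .{{_ : NonZero N}} m → m / N % 2 ≡ 1 → S N (suc m) ≡ suc (m % N)
S-suc-odd N m odd with m / N % 2 ≟ 0
... | yes even = contradiction (trans (sym even) odd) λ ()
... | no _     = suc∸m/n*n≡suc[m%n] m N

code-map-eqb-decode≡S∸1 : ∀ p m →
  code (map (eqb (bit ((m / 2 ^ p) {{m^n≢0 2 p}} % 2))) (toList (decode p m))) ≡ S (2 ^ p) {{m^n≢0 2 p}} (suc m) ∸ 1
code-map-eqb-decode≡S∸1 p m with n%2≡0⊎n%2≡1 ((m / 2 ^ p) {{m^n≢0 2 p}})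
... | inj₁ even = begin
  code (map (eqb (bit (m / 2 ^ p % 2))) xs) ≡⟨ cong (λ d → code (map (eqb (bit d)) xs)) even ⟩
  code (map (eqb false) xs)                 ≡⟨ cong code (map-cong eqb-false xs) ⟩
  code (map not xs)                         ≡⟨ code-map-not xs ⟩
  2 ^ length xs ∸ code xs ∸ 1               ≡⟨ cong₂ (λ l c → 2 ^ l ∸ c ∸ 1) (length-toList (decode p m)) (code-decode p m) ⟩
  2 ^ p ∸ m % 2 ^ p ∸ 1                     ≡⟨ cong (_∸ 1) (S-suc-even (2 ^ p) m even) ⟨
  S (2 ^ p) (suc m) ∸ 1                     ∎
  where
  instance _ = m^n≢0 2 p
  xs = toList (decode p m)
... | inj₂ odd = begin
  code (map (eqb (bit (m / 2 ^ p % 2))) xs) ≡⟨ cong (λ d → code (map (eqb (bit d)) xs)) odd ⟩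
  code (map (eqb true) xs)                  ≡⟨ cong code (map-eqb-true xs) ⟩
  code xs                                   ≡⟨ code-decode p m ⟩
  m % 2 ^ p                                 ≡⟨ cong (_∸ 1) (S-suc-odd (2 ^ p) m odd) ⟨
  S (2 ^ p) (suc m) ∸ 1                     ∎
  where
  instance _ = m^n≢0 2 p
  xs = toList (decode p m)

code-lam-decode-suc : ∀ p m →
  code (lam (toList (decode (suc p) m))) ≡ sumFrom1 p (λ j → 2 ^ choose2 j * (S (2 ^ j) {{m^n≢0 2 j}} (suc m) ∸ 1))
code-lam-decode-suc zero    m = refl
code-lam-decode-suc (suc p) m = begin
  code (lam (b ∷ xs))
    ≡⟨ code-lam-∷ b xs ⟩
  code (map (eqb b) xs) * 2 ^ choose2 (length xs) + code (lam xs)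
    ≡⟨ cong₂ (λ c l → c * 2 ^ choose2 l + code (lam xs)) (code-map-eqb-decode≡S∸1 (suc p) m) (length-toList (decode (suc p) m)) ⟩
  row (suc p) * 2 ^ choose2 (suc p) + code (lam xs)
    ≡⟨ cong₂ _+_ (*-comm (row (suc p)) (2 ^ choose2 (suc p))) (code-lam-decode-suc p m) ⟩
  2 ^ choose2 (suc p) * row (suc p) + sumFrom1 p (λ j → 2 ^ choose2 j * row j)
    ≡⟨ +-comm _ (sumFrom1 p (λ j → 2 ^ choose2 j * row j)) ⟩
  sumFrom1 (suc p) (λ j → 2 ^ choose2 j * row j) ∎
  where
  b = bit ((m / 2 ^ suc p) {{m^n≢0 2 (suc p)}} % 2)
  xs = toList (decode (suc p) m)
  row : ℕ → ℕ
  row j = S (2 ^ j) {{m^n≢0 2 j}} (suc m) ∸ 1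

v-suc : ∀ p {m} → m < 2 ^ p → v (suc p) (suc m) ≡ 2 ^ choose2 p * m + code (lam (toList (decode p m)))
v-suc p {m} m<2^p = begin
  code (lam (toList (decode (suc p) (2 ^ p + suc m ∸ 1))))
    ≡⟨ cong (λ a → code (lam (toList (decode (suc p) (a ∸ 1))))) (+-suc (2 ^ p) m) ⟩
  code (lam (toList (decode (suc p) (2 ^ p + m))))
    ≡⟨ cong (λ x → code (lam (toList x))) (decode-suc-2^+ p m<2^p) ⟩
  code (lam (true ∷ xs))
    ≡⟨ code-lam-∷ true xs ⟩
  code (map (eqb true) xs) * 2 ^ choose2 (length xs) + code (lam xs)
    ≡⟨ cong₂ (λ c l → c * 2 ^ choose2 l + code (lam xs)) digits (length-toList (decode p m)) ⟩
  m * 2 ^ choose2 p + code (lam xs)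
    ≡⟨ cong (_+ code (lam xs)) (*-comm m (2 ^ choose2 p)) ⟩
  2 ^ choose2 p * m + code (lam xs) ∎
  where
  instance _ = m^n≢0 2 p
  xs = toList (decode p m)
  digits : code (map (eqb true) xs) ≡ m
  digits = trans (cong code (map-eqb-true xs)) (trans (code-decode p m) (m<n⇒m%n≡m m<2^p))

theorem1 : (v 1 1 ≡ 0)
    × (v 2 1 ≡ 0 × v 2 2 ≡ 1)
    × (∀ (n k : ℕ) → n ≥ 3 → 1 ≤ k → k ≤ 2 ^ (n ∸ 1) →
        v n k ≡ 2 ^ choose2 (n ∸ 1) * (k ∸ 1)
                + sumFrom1 (n ∸ 2) (λ j → 2 ^ choose2 j * (S (2 ^ j) {{m^n≢0 2 j}} k ∸ 1)))
theorem1 = refl , (refl , refl) , λ where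
  (suc (suc (suc p))) (suc m) _ _ k≤2^[n∸1] →
    trans (v-suc (suc (suc p)) k≤2^[n∸1]) (cong (2 ^ choose2 (suc (suc p)) * m +_) (code-lam-decode-suc (suc p) m))
  (suc zero)       _ (s≤s ()) _ _
  (suc (suc zero)) _ (s≤s (s≤s ())) _ _
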